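{- Let $n,C$ be integers with $n\ge 4C\ge 0$ and $n\ge 3$, and let $G\subseteq K_n$ be a graph with $V(G)=V(K_n)$ such that $D(G):=\{v\in V(G): d_G(v)>0\}$ has size at most $\frac{n-C}{2}$. Then in the Blocker-start $C$-BSFN game played on the edges of $K_n\setminus G$, Constructor can build a matching in $K_n\setminus G$ with at least $\left\lfloor \frac{n-4C-1}{2}\right\rfloor$ edges.
   Context: The Blocker-start $C$-BSFN game on $K_n\setminus G$: Blocker and Constructor alternately claim previously unclaimed edges of $K_n$ not belonging to $G$, Blocker moving first. Blocker may claim any such edge. Before each Constructor move a family $\{F_v : v\in V(K_n)\}$ of vertex sets is given (arbitrarily, possibly changing from move to move) with $|F_v|\le C$ for all $v$ and $u\in F_v$ iff $v\in F_u$, and Constructor may not claim an edge $uv$ with $u\in F_v$. -}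

module Defs where

open import Data.Nat using (ℕ; _≤_; _∸_; _*_)
open import Data.Bool using (Bool; true; false; _∨_; _∧_)
open import Data.Fin using (Fin; _≟_)
open import Data.Fin.Subset using (Subset; _∈_; ∣_∣)
open import Data.Vec using (tabulate)
open import Data.List using (List; []; _∷_; length; concatMap; allFin)
open import Data.Bool.ListAction using (any)
open import Data.List.Relation.Unary.All using (All)
open import Data.List.Relation.Unary.Unique.Propositional using (Unique)
open import Data.Product using (_×_; _,_; Σ; ∃; proj₁; proj₂)
open import Relation.Binary.PropositionalEquality using (_≡_; _≢_)
open import Relation.Nullary using (¬_)
open import Relation.Nullary.Decidable using (⌊_⌋)

-- An edge set on vertex set Fin n, given by a Boolean adjacency function.
-- (All edge sets used are symmetric: an edge uv is present iff E u v ≡ true.)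
EdgeSet : ℕ → Set
EdgeSet n = Fin n → Fin n → Bool

emptyE : ∀ {n} → EdgeSet n
emptyE _ _ = false

addE : ∀ {n} → EdgeSet n → Fin n → Fin n → EdgeSet n
addE E u v x y = E x y ∨ ((⌊ x ≟ u ⌋ ∧ ⌊ y ≟ v ⌋) ∨ (⌊ x ≟ v ⌋ ∧ ⌊ y ≟ u ⌋))

SimpleGraph : ∀ {n} → EdgeSet n → Set
SimpleGraph G = (∀ u v → G u v ≡ G v u) × (∀ v → G v v ≡ false)

D : ∀ {n} → EdgeSet n → Subset n
D {n} G = tabulate (λ v → any (λ u → G u v) (allFin n))

-- The edge uv of K_n \ G is still unclaimed (B = Blocker's edges, Cs = Constructor's edges)
Free : ∀ {n} → EdgeSet n → EdgeSet n → EdgeSet n → Fin n → Fin n → Set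
Free G B Cs u v = (u ≢ v) × (G u v ≡ false) × (B u v ≡ false) × (Cs u v ≡ false)

record Family (n C : ℕ) : Set where
  field
    F    : Fin n → Subset n
    size : ∀ v → ∣ F v ∣ ≤ C
    sym  : ∀ u v → u ∈ F v → v ∈ F u

HasMatching : ∀ {n} → EdgeSet n → ℕ → Set
HasMatching {n} E k =
  Σ (List (Fin n × Fin n)) λ M →
    (k ≤ length M)
    × All (λ e → E (proj₁ e) (proj₂ e) ≡ true) M
    × Unique (concatMap (λ e → proj₁ e ∷ proj₂ e ∷ []) M)

-- Constructor can force a matching of size ≥ k in the Blocker-start C-BSFN game
-- on K_n \ G, from the position (B, Cs) with Blocker to move.
mutual
  data CWinsB (n C : ℕ) (G : EdgeSet n) (k : ℕ) (B Cs : EdgeSet n) : Set where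
    won  : HasMatching Cs k → CWinsB n C G k B Cs
    -- the game is not over (an unclaimed edge exists), and whatever edge
    -- Blocker claims and whatever family F is then given, Constructor can answer
    step : (∃ λ u → ∃ λ v → Free G B Cs u v)
         → (∀ u v → Free G B Cs u v → (F : Family n C) → CWinsC n C G k (addE B u v) Cs F)
         → CWinsB n C G k B Cs

  data CWinsC (n C : ℕ) (G : EdgeSet n) (k : ℕ) (B Cs : EdgeSet n) (F : Family n C) : Set where
    claim : ∀ u v → Free G B Cs u v → ¬ (u ∈ Family.F F v)
          → CWinsB n C G k B (addE Cs u v) → CWinsC n C G k B Cs F
    -- Constructor has no legal move and skips his turn
    pass  : (∀ u v → Free G B Cs u v → u ∈ Family.F F v)
          → CWinsB n C G k B Cs → CWinsC n C G k B Cs F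

ConstructorCanBuildMatching : (n C : ℕ) → EdgeSet n → ℕ → Set
ConstructorCanBuildMatching n C G k = CWinsB n C G k emptyE emptyE

-- Constructor keeps a set U of untouched vertices: no vertex of U is covered by
-- his matching M or by any of his edges, U spans no Blocker edge, and
-- n ≤ 2|M| + |U|. When Blocker claims pq, Constructor matches an endpoint u of
-- pq lying in U (any vertex of U if pq leaves U) with a partner w ∈ U ∖ {p, q}
-- outside F_u, and removes u and w from U; this destroys the only Blocker edge
-- inside U. One of u, w always lies outside D(G), so the new edge avoids G. For this
-- Constructor maintains, with a = |U ∖ D| and b = |U ∩ D|, that b + C ≤ a or
-- b ≤ C: while b > C he pairs a vertex of D with one outside D. As long as
-- |M| < ⌊(n − 4C − 1)/2⌋ we have |U| ≥ 3 + 4C, so that a is large enough to find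
-- w despite the at most C vertices of F_u.
module Submission where

open import Defs
open import Data.Nat using (ℕ; _≤_; _∸_; _*_; _/_)
open import Data.Fin.Subset using (∣_∣)

open import Data.Bool using (true; false)
open import Data.Bool.Properties using (T-≡; ∨-zeroʳ; ¬-not)
open import Data.Fin using (Fin; _≟_)
open import Data.Fin.Subset
  using (Subset; inside; outside; _∈_; _∉_; _⊆_; _∩_; _─_; _-_; ⁅_⁆; ⊤; Nonempty)
open import Data.Fin.Subset.Properties
  using ( _∈?_; drop-there; p─q⊆p; x∈p∧x∉q⇒x∈p─q; x∈p∧x≢y⇒x∈p-y; x∉⁅y⁆⇒x≢y; x∈p∩q⁺; x∈p∩q⁻
        ; ∣p∩q∣≤∣q∣; p⊆q⇒∣p∣≤∣q∣; x∈p⇒∣p-x∣<∣p∣; ∣⁅x⁆∣≡1; ∣⊤∣≡n; ∣⊥∣≡0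
        ; nonempty?; Empty-unique; p─x─y≡p─y─x; ∩-identityˡ)
open import Data.List using (List; []; _∷_; length; concatMap)
open import Data.List.Membership.Propositional.Properties using (∈-allFin)
open import Data.List.Relation.Unary.All using (All; []; _∷_)
import Data.List.Relation.Unary.All as All
import Data.List.Relation.Unary.Any as Any
open import Data.List.Relation.Unary.Any.Properties using (any⁺)
open import Data.List.Relation.Unary.AllPairs using ([]; _∷_)
open import Data.List.Relation.Unary.Unique.Propositional using (Unique)
open import Data.Nat using (zero; suc; _+_; _<_; _≤?_; z≤n; s≤s; s≤s⁻¹)
open import Data.Nat.DivMod using (m/n*n≤m)
open import Data.Nat.Properties
  using ( ≤-refl; ≤-reflexive; ≤-trans; <-≤-trans; ≤-<-trans; <⇒≤; ≰⇒>; >⇒≢; m≤m+n; m≤n*m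
        ; +-comm; +-suc; n≤1+n; +-identityʳ; +-monoˡ-≤; +-monoʳ-≤; +-cancelˡ-≤; +-cancelʳ-<
        ; *-comm; *-monoʳ-≤; *-cancelˡ-<; ∸-+-assoc; m∸n+n≡m; m∸n≢0⇒n<m; m≤o∸n⇒m+n≤o
        ; module ≤-Reasoning)
open import Data.Nat.Tactic.RingSolver using (solve-∀)
open import Data.Product using (∃; ∃₂; _×_; _,_; proj₁; proj₂)
import Data.Product as Product
open import Data.Sum using (_⊎_; inj₁; inj₂; [_,_]; [_,_]′)
open import Data.Vec using ([]; _∷_; here; there)
open import Data.Vec.Properties using (lookup⇒[]=; lookup∘tabulate)
open import Function using (_∘_)
open import Function.Bundles using (Equivalence)
open import Relation.Binary.PropositionalEquality
  using (_≡_; _≢_; ≢-sym; refl; sym; trans; cong; subst)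
open import Relation.Nullary using (yes; no; contradiction)

private
  variable
    n : ℕ
    x y : Fin n

∣p∣≡∣p∩q∣+∣p─q∣ : ∀ (p q : Subset n) → ∣ p ∣ ≡ ∣ p ∩ q ∣ + ∣ p ─ q ∣
∣p∣≡∣p∩q∣+∣p─q∣ []            []            = refl
∣p∣≡∣p∩q∣+∣p─q∣ (outside ∷ p) (inside  ∷ q) = ∣p∣≡∣p∩q∣+∣p─q∣ p q
∣p∣≡∣p∩q∣+∣p─q∣ (outside ∷ p) (outside ∷ q) = ∣p∣≡∣p∩q∣+∣p─q∣ p q
∣p∣≡∣p∩q∣+∣p─q∣ (inside  ∷ p) (inside  ∷ q) = cong suc (∣p∣≡∣p∩q∣+∣p─q∣ p q)
∣p∣≡∣p∩q∣+∣p─q∣ (inside  ∷ p) (outside ∷ q) =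
  trans (cong suc (∣p∣≡∣p∩q∣+∣p─q∣ p q)) (sym (+-suc _ _))

∣p∣≤∣p─q∣+∣q∣ : ∀ (p q : Subset n) → ∣ p ∣ ≤ ∣ p ─ q ∣ + ∣ q ∣
∣p∣≤∣p─q∣+∣q∣ p q = begin
  ∣ p ∣                  ≡⟨ ∣p∣≡∣p∩q∣+∣p─q∣ p q ⟩
  ∣ p ∩ q ∣ + ∣ p ─ q ∣  ≤⟨ +-monoˡ-≤ _ (∣p∩q∣≤∣q∣ p q) ⟩
  ∣ q ∣ + ∣ p ─ q ∣      ≡⟨ +-comm ∣ q ∣ _ ⟩
  ∣ p ─ q ∣ + ∣ q ∣      ∎
  where open ≤-Reasoning

∣p∣≤1+∣p-x∣ : ∀ (p : Subset n) x → ∣ p ∣ ≤ suc ∣ p - x ∣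
∣p∣≤1+∣p-x∣ p x = begin
  ∣ p ∣                  ≤⟨ ∣p∣≤∣p─q∣+∣q∣ p ⁅ x ⁆ ⟩
  ∣ p - x ∣ + ∣ ⁅ x ⁆ ∣  ≡⟨ cong (∣ p - x ∣ +_) (∣⁅x⁆∣≡1 x) ⟩
  ∣ p - x ∣ + 1          ≡⟨ +-comm ∣ p - x ∣ 1 ⟩
  suc ∣ p - x ∣          ∎
  where open ≤-Reasoning

x∈p─q⁻ : ∀ (p q : Subset n) → x ∈ p ─ q → x ∈ p × x ∉ q
x∈p─q⁻ p q x∈p─q = p─q⊆p p q x∈p─q , ∉q p q x∈p─q
  where
    ∉q : ∀ {n} {x : Fin n} (p q : Subset n) → x ∈ p ─ q → x ∉ q
    ∉q (_ ∷ p) (outside ∷ q) here       ()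
    ∉q (_ ∷ p) (_       ∷ q) (there x∈) = ∉q p q x∈ ∘ drop-there

∣p∣≤2+∣p-x-y∣ : ∀ (p : Subset n) x y → ∣ p ∣ ≤ 2 + ∣ p - x - y ∣
∣p∣≤2+∣p-x-y∣ p x y = ≤-trans (∣p∣≤1+∣p-x∣ p x) (s≤s (∣p∣≤1+∣p-x∣ (p - x) y))

x∈p-y⁻ : ∀ (p : Subset n) y → x ∈ p - y → x ∈ p × x ≢ y
x∈p-y⁻ p y = Product.map₂ x∉⁅y⁆⇒x≢y ∘ x∈p─q⁻ p ⁅ y ⁆

x∈p-y-z⁻ : ∀ (p : Subset n) y z → x ∈ p - y - z → x ∈ p × x ≢ y × x ≢ z
x∈p-y-z⁻ p y z x∈ =
  let x∈p-y , x≢z = x∈p-y⁻ (p - y) z x∈ in Product.map₂ (_, x≢z) (x∈p-y⁻ p y x∈p-y)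

∣p∣>0⇒nonempty : ∀ (p : Subset n) → 0 < ∣ p ∣ → Nonempty p
∣p∣>0⇒nonempty {n} p 0<∣p∣ with nonempty? p
... | yes nonempty = nonempty
... | no empty     =
  contradiction (trans (cong ∣_∣ (Empty-unique empty)) (∣⊥∣≡0 n)) (>⇒≢ 0<∣p∣)

∣q∣<∣p∣⇒∃∈p∉q : ∀ (p q : Subset n) → ∣ q ∣ < ∣ p ∣ → ∃ λ x → x ∈ p × x ∉ q
∣q∣<∣p∣⇒∃∈p∉q p q ∣q∣<∣p∣ =
  Product.map₂ (x∈p─q⁻ p q) (∣p∣>0⇒nonempty (p ─ q) 0<∣p─q∣)
  where
    0<∣p─q∣ : 0 < ∣ p ─ q ∣
    0<∣p─q∣ = +-cancelʳ-< ∣ q ∣ 0 _ (<-≤-trans ∣q∣<∣p∣ (∣p∣≤∣p─q∣+∣q∣ p q))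

addE-new : ∀ (E : EdgeSet n) u v → addE E u v u v ≡ true
addE-new E u v with u ≟ u | v ≟ v
... | yes _   | yes _   = ∨-zeroʳ (E u v)
... | no u≢u  | _       = contradiction refl u≢u
... | yes _   | no v≢v  = contradiction refl v≢v

addE-⊇ : ∀ (E : EdgeSet n) u v → E x y ≡ true → addE E u v x y ≡ true
addE-⊇ E u v Exy rewrite Exy = refl

addE⁻ : ∀ (E : EdgeSet n) u v → addE E u v x y ≡ true
      → E x y ≡ true ⊎ (x ≡ u × y ≡ v) ⊎ (x ≡ v × y ≡ u)
addE⁻ {x = x} {y} E u v new with E x y | x ≟ u | y ≟ v | x ≟ v | y ≟ u
... | true  | _        | _        | _        | _        = inj₁ refl
... | false | yes refl | yes refl | _        | _        = inj₂ (inj₁ (refl , refl))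
... | false | _        | _        | yes refl | yes refl = inj₂ (inj₂ (refl , refl))
... | false | yes _    | no _     | yes _    | no _     with () ← new
... | false | yes _    | no _     | no _     | _        with () ← new
... | false | no _     | _        | yes _    | no _     with () ← new
... | false | no _     | _        | no _     | _        with () ← new

edge⇒∈D : ∀ (G : EdgeSet n) → G x y ≡ true → y ∈ D G
edge⇒∈D {n} {x} {y} G Gxy = lookup⇒[]= y (D G)
  (trans (lookup∘tabulate _ y)
         (Equivalence.to T-≡ (any⁺ _ (Any.map (λ { refl → Equivalence.from T-≡ Gxy })
                                                (∈-allFin x)))))

∉D⇒non-edge : ∀ {G : EdgeSet n} → SimpleGraph G → x ∉ D G ⊎ y ∉ D G → G x y ≡ false
∉D⇒non-edge {x = x} {y} {G} (symmetric , _) x∉D⊎y∉D =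
  ¬-not λ Gxy → [ (λ x∉D → x∉D (edge⇒∈D G (trans (symmetric y x) Gxy)))
                , (λ y∉D → y∉D (edge⇒∈D G Gxy)) ] x∉D⊎y∉D

-- Balanced sets of untouched vertices

module _ (C : ℕ) (D : Subset n) where

  Balanced : Subset n → Set
  Balanced U = ∣ U ∩ D ∣ + C ≤ ∣ U ─ D ∣ ⊎ ∣ U ∩ D ∣ ≤ C

  data Admissible (U : Subset n) (u w : Fin n) : Set where
    inside-outside  : u ∈ D → w ∉ D → Admissible U u w
    outside-inside  : u ∉ D → w ∈ D → Admissible U u w
    outside-outside : u ∉ D → w ∉ D → ∣ U ∩ D ∣ ≤ C → Admissible U u w

  ∉∧∈⇒≢ : x ∉ D → y ∈ D → x ≢ y
  ∉∧∈⇒≢ x∉D y∈D refl = x∉D y∈D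

  admissible⇒∉D : ∀ {U u w} → Admissible U u w → w ∉ D ⊎ u ∉ D
  admissible⇒∉D (inside-outside  _   w∉D)   = inj₁ w∉D
  admissible⇒∉D (outside-inside  u∉D _)     = inj₂ u∉D
  admissible⇒∉D (outside-outside u∉D _ _)   = inj₂ u∉D

  private
    shrink-balance : ∀ {a a′ b b′} → b′ < b → a ≤ suc a′
                   → b + C ≤ a ⊎ b ≤ C → b′ + C ≤ a′ ⊎ b′ ≤ C
    shrink-balance b′<b _    (inj₂ b≤C)   = inj₂ (≤-trans (<⇒≤ b′<b) b≤C)
    shrink-balance b′<b a≤1+a′ (inj₁ b+C≤a) =
      inj₁ (s≤s⁻¹ (≤-trans (+-monoˡ-≤ C b′<b) (≤-trans b+C≤a a≤1+a′)))

  remove-inside-outside : ∀ {U u w} → u ∈ U → u ∈ D → w ∈ U → w ∉ D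
    → ∣ (U - u - w) ∩ D ∣ < ∣ U ∩ D ∣ × ∣ U ─ D ∣ ≤ suc ∣ (U - u - w) ─ D ∣
  remove-inside-outside {U} {u} {w} u∈U u∈D w∈U w∉D =
      ≤-<-trans (p⊆q⇒∣p∣≤∣q∣ inside-shrinks) (x∈p⇒∣p-x∣<∣p∣ (x∈p∩q⁺ (u∈U , u∈D)))
    , ≤-trans (∣p∣≤1+∣p-x∣ (U ─ D) w) (s≤s (p⊆q⇒∣p∣≤∣q∣ outside-keeps))
    where
      inside-shrinks : (U - u - w) ∩ D ⊆ (U ∩ D) - u
      inside-shrinks x∈ =
        let x∈U-u-w , x∈D = x∈p∩q⁻ (U - u - w) D x∈
            x∈U , x≢u , _ = x∈p-y-z⁻ U u w x∈U-u-w
        in x∈p∧x≢y⇒x∈p-y (x∈p∩q⁺ (x∈U , x∈D)) x≢u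
      outside-keeps : (U ─ D) - w ⊆ (U - u - w) ─ D
      outside-keeps x∈ =
        let x∈U─D , x≢w = x∈p-y⁻ (U ─ D) w x∈
            x∈U , x∉D   = x∈p─q⁻ U D x∈U─D
            x∈U-u-w     = x∈p∧x≢y⇒x∈p-y (x∈p∧x≢y⇒x∈p-y x∈U (∉∧∈⇒≢ x∉D u∈D)) x≢w
        in x∈p∧x∉q⇒x∈p─q x∈U-u-w x∉D

  balanced-remove : ∀ {U u w} → Balanced U → u ∈ U → w ∈ U → Admissible U u w
                  → Balanced (U - u - w)
  balanced-remove bal u∈U w∈U (inside-outside u∈D w∉D) =
    let fewer , most = remove-inside-outside u∈U u∈D w∈U w∉D in shrink-balance fewer most bal
  balanced-remove {U} {u} {w} bal u∈U w∈U (outside-inside u∉D w∈D) =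
    let fewer , most = remove-inside-outside w∈U w∈D u∈U u∉D
    in subst Balanced (p─x─y≡p─y─x U w u) (shrink-balance fewer most bal)
  balanced-remove {U} {u} {w} _ _ _ (outside-outside _ _ b≤C) =
    inj₂ (≤-trans (p⊆q⇒∣p∣≤∣q∣ inside-shrinks) b≤C)
    where
      inside-shrinks : (U - u - w) ∩ D ⊆ U ∩ D
      inside-shrinks x∈ =
        let x∈U-u-w , x∈D = x∈p∩q⁻ (U - u - w) D x∈
        in x∈p∩q⁺ (proj₁ (x∈p-y-z⁻ U u w x∈U-u-w) , x∈D)

  enough-outside-if-few-inside : ∀ U → 3 + 4 * C ≤ ∣ U ∣ → ∣ U ∩ D ∣ ≤ C
                               → 3 + C ≤ ∣ U ─ D ∣
  enough-outside-if-few-inside U large few = +-cancelˡ-≤ C _ _ (begin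
    C + (3 + C)              ≤⟨ m≤m+n _ (2 * C) ⟩
    C + (3 + C) + 2 * C      ≡⟨ rearrange C ⟩
    3 + 4 * C                ≤⟨ large ⟩
    ∣ U ∣                    ≡⟨ ∣p∣≡∣p∩q∣+∣p─q∣ U D ⟩
    ∣ U ∩ D ∣ + ∣ U ─ D ∣    ≤⟨ +-monoˡ-≤ _ few ⟩
    C + ∣ U ─ D ∣            ∎)
    where
      open ≤-Reasoning
      rearrange : ∀ C → C + (3 + C) + 2 * C ≡ 3 + 4 * C
      rearrange = solve-∀

  enough-outside : ∀ U → 3 + 4 * C ≤ ∣ U ∣ → Balanced U → 2 + C ≤ ∣ U ─ D ∣
  enough-outside U large (inj₂ few) =
    ≤-trans (n≤1+n _) (enough-outside-if-few-inside U large few)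
  enough-outside U large (inj₁ b+C≤a) = *-cancelˡ-< 2 (1 + C) ∣ U ─ D ∣ (begin-strict
    2 * (1 + C)                  <⟨ s≤s (m≤m+n _ (3 * C)) ⟩
    suc (2 * (1 + C) + 3 * C)    ≡⟨ rearrange C ⟩
    3 + 4 * C + C                ≤⟨ +-monoˡ-≤ C large ⟩
    ∣ U ∣ + C                    ≡⟨ cong (_+ C) (∣p∣≡∣p∩q∣+∣p─q∣ U D) ⟩
    b + a + C                    ≡⟨ swap b a C ⟩
    b + C + a                    ≤⟨ +-monoˡ-≤ a b+C≤a ⟩
    a + a                        ≡⟨ double a ⟩
    2 * a                        ∎)
    where
      open ≤-Reasoning
      a = ∣ U ─ D ∣
      b = ∣ U ∩ D ∣
      rearrange : ∀ C → suc (2 * (1 + C) + 3 * C) ≡ 3 + 4 * C + C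
      rearrange = solve-∀
      swap : ∀ b a C → b + a + C ≡ b + C + a
      swap = solve-∀
      double : ∀ a → a + a ≡ 2 * a
      double = solve-∀

  record Partner (F : Fin n → Subset n) (U : Subset n) (p q : Fin n) : Set where
    constructor partner-of
    field
      {u w}      : Fin n
      u≡p⊎u≡q    : u ≡ p ⊎ u ≡ q
      w∈U        : w ∈ U
      w≢p        : w ≢ p
      w≢q        : w ≢ q
      w∉Fu       : w ∉ F u
      admissible : Admissible U u w

  module _ {U : Subset n} (F : Fin n → Subset n) (∣F∣≤C : ∀ v → ∣ F v ∣ ≤ C)
           (large : 3 + 4 * C ≤ ∣ U ∣) (bal : Balanced U) where

    private
      ∣Fv∣<∣U─D-o∣ : ∀ v o → ∣ F v ∣ < ∣ U ─ D - o ∣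
      ∣Fv∣<∣U─D-o∣ v o = ≤-trans (s≤s (∣F∣≤C v))
        (s≤s⁻¹ (≤-trans (enough-outside U large bal) (∣p∣≤1+∣p-x∣ (U ─ D) o)))

      ∣Fv∣<∣U─D-p-q∣ : ∣ U ∩ D ∣ ≤ C → ∀ v p q → ∣ F v ∣ < ∣ U ─ D - p - q ∣
      ∣Fv∣<∣U─D-p-q∣ few v p q = ≤-trans (s≤s (∣F∣≤C v)) (s≤s⁻¹ (s≤s⁻¹ (begin
        3 + C                  ≤⟨ enough-outside-if-few-inside U large few ⟩
        ∣ U ─ D ∣              ≤⟨ ∣p∣≤2+∣p-x-y∣ (U ─ D) p q ⟩
        2 + ∣ U ─ D - p - q ∣  ∎)))
        where open ≤-Reasoning

      outside-partner : ∀ v o → ∃ λ w → w ∈ U × w ∉ D × w ≢ o × w ∉ F v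
      outside-partner v o =
        let w , w∈ , w∉Fv = ∣q∣<∣p∣⇒∃∈p∉q (U ─ D - o) (F v) (∣Fv∣<∣U─D-o∣ v o)
            w∈U─D , w≢o   = x∈p-y⁻ (U ─ D) o w∈
            w∈U , w∉D     = x∈p─q⁻ U D w∈U─D
        in w , w∈U , w∉D , w≢o , w∉Fv

    partner : ∀ p q → Partner F U p q
    partner p q with p ∈? D | q ∈? D | ∣ U ∩ D ∣ ≤? C
    ... | yes p∈D | _       | _ =
      let w , w∈U , w∉D , w≢q , w∉Fp = outside-partner p q
      in partner-of (inj₁ refl) w∈U (∉∧∈⇒≢ w∉D p∈D) w≢q w∉Fp (inside-outside p∈D w∉D)
    ... | no _    | yes q∈D | _ =
      let w , w∈U , w∉D , w≢p , w∉Fq = outside-partner q p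
      in partner-of (inj₂ refl) w∈U w≢p (∉∧∈⇒≢ w∉D q∈D) w∉Fq (inside-outside q∈D w∉D)
    ... | no p∉D  | no q∉D  | yes few =
      let w , w∈ , w∉Fp        = ∣q∣<∣p∣⇒∃∈p∉q (U ─ D - p - q) (F p) (∣Fv∣<∣U─D-p-q∣ few p p q)
          w∈U─D , w≢p , w≢q    = x∈p-y-z⁻ (U ─ D) p q w∈
          w∈U , w∉D            = x∈p─q⁻ U D w∈U─D
      in partner-of (inj₁ refl) w∈U w≢p w≢q w∉Fp (outside-outside p∉D w∉D few)
    ... | no p∉D  | no q∉D  | no many =
      let w , w∈U∩D , w∉Fp = ∣q∣<∣p∣⇒∃∈p∉q (U ∩ D) (F p) (≤-trans (s≤s (∣F∣≤C p)) (≰⇒> many))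
          w∈U , w∈D        = x∈p∩q⁻ U D w∈U∩D
      in partner-of (inj₁ refl) w∈U (≢-sym (∉∧∈⇒≢ p∉D w∈D)) (≢-sym (∉∧∈⇒≢ q∉D w∈D)) w∉Fp
                    (outside-inside p∉D w∈D)

-- Blocker's edges inside the untouched set

Independent : EdgeSet n → Subset n → Set
Independent B U = ∀ x y → B x y ≡ true → x ∈ U → y ∉ U

IndependentExcept : EdgeSet n → Subset n → Fin n → Fin n → Set
IndependentExcept B U p q =
  ∀ x y → B x y ≡ true → x ∈ U → y ∈ U → (x ≡ p × y ≡ q) ⊎ (x ≡ q × y ≡ p)

module _ {B : EdgeSet n} {U : Subset n} where

  independent-addE : Independent B U → ∀ p q → IndependentExcept (addE B p q) U p q
  independent-addE indep p q x y new x∈U y∈U with addE⁻ B p q new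
  ... | inj₁ old  = contradiction y∈U (indep x y old x∈U)
  ... | inj₂ pair = pair

  independentExcept-remove : ∀ {p q u} → IndependentExcept B U p q → u ≡ p ⊎ u ≡ q
                           → ∀ w → Independent B (U - u - w)
  independentExcept-remove {u = u} except u≡p⊎u≡q w x y Bxy x∈ y∈
    with x∈U , x≢u , _ ← x∈p-y-z⁻ U u w x∈
       | y∈U , y≢u , _ ← x∈p-y-z⁻ U u w y∈
    with except x y Bxy x∈U y∈U | u≡p⊎u≡q
  ... | inj₁ (refl , refl) | inj₁ refl = x≢u refl
  ... | inj₁ (refl , refl) | inj₂ refl = y≢u refl
  ... | inj₂ (refl , refl) | inj₁ refl = y≢u refl
  ... | inj₂ (refl , refl) | inj₂ refl = x≢u refl

  independentExcept⇒non-edge : ∀ {p q w u} → IndependentExcept B U p q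
                             → w ∈ U → u ∈ U → w ≢ p → w ≢ q → B w u ≡ false
  independentExcept⇒non-edge {w = w} {u} except w∈U u∈U w≢p w≢q =
    ¬-not λ Bwu → [ w≢p ∘ proj₁ , w≢q ∘ proj₁ ] (except w u Bwu w∈U u∈U)

  -- If Blocker's new edge leaves U, then U stays independent and any v ∈ U serves as p′ = q′.
  addE-independentExcept : Independent B U → Nonempty U → ∀ p q
    → ∃₂ λ p′ q′ → p′ ∈ U × q′ ∈ U × IndependentExcept (addE B p q) U p′ q′
  addE-independentExcept indep (v , v∈U) p q with p ∈? U | q ∈? U
  ... | yes p∈U | yes q∈U = p , q , p∈U , q∈U , independent-addE indep p q
  ... | no p∉U  | _       = v , v , v∈U , v∈U , λ x y new x∈U y∈U →
    contradiction (independent-addE indep p q x y new x∈U y∈U)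
                  [ p∉U ∘ (λ { (refl , _) → x∈U }) , p∉U ∘ (λ { (_ , refl) → y∈U }) ]
  ... | yes _   | no q∉U  = v , v , v∈U , v∈U , λ x y new x∈U y∈U →
    contradiction (independent-addE indep p q x y new x∈U y∈U)
                  [ q∉U ∘ (λ { (_ , refl) → y∈U }) , q∉U ∘ (λ { (refl , _) → x∈U }) ]

-- The strategy

vertices : List (Fin n × Fin n) → List (Fin n)
vertices = concatMap (λ e → proj₁ e ∷ proj₂ e ∷ [])

few-matched⇒large : ∀ {n C k m t} → m < k → 2 * k ≤ n ∸ 4 * C ∸ 1 → n ≤ 2 * m + t
                  → 3 + 4 * C ≤ t
few-matched⇒large {n} {C} {k} {m} {t} m<k 2k≤ n≤ = +-cancelˡ-≤ (2 * m) _ _ (begin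
  2 * m + (3 + 4 * C)                  ≡⟨ rearrange m C ⟩
  2 * suc m + (4 * C + 1)              ≤⟨ +-monoˡ-≤ _ 2+2m≤ ⟩
  n ∸ (4 * C + 1) + (4 * C + 1)        ≡⟨ m∸n+n≡m {n} {4 * C + 1} 4C+1≤n ⟩
  n                                    ≤⟨ n≤ ⟩
  2 * m + t                            ∎)
  where
    open ≤-Reasoning
    rearrange : ∀ m C → 2 * m + (3 + 4 * C) ≡ 2 * suc m + (4 * C + 1)
    rearrange = solve-∀
    2+2m≤ : 2 * suc m ≤ n ∸ (4 * C + 1)
    2+2m≤ = ≤-trans (*-monoʳ-≤ 2 m<k) (subst (2 * k ≤_) (∸-+-assoc n (4 * C) 1) 2k≤)
    4C+1≤n : 4 * C + 1 ≤ n
    4C+1≤n = <⇒≤ (m∸n≢0⇒n<m (>⇒≢ (≤-trans (s≤s z≤n) 2+2m≤)))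

initially-balanced : ∀ C (D : Subset n) → C ≤ n → 2 * ∣ D ∣ ≤ n ∸ C → Balanced C D ⊤
initially-balanced {n} C D C≤n 2∣D∣≤ = inj₁ (+-cancelˡ-≤ b _ _ (begin
  b + (b + C)   ≡⟨ rearrange b C ⟩
  2 * b + C     ≤⟨ m≤o∸n⇒m+n≤o (2 * b) C≤n (subst (λ d → 2 * d ≤ n ∸ C) (sym b≡∣D∣) 2∣D∣≤) ⟩
  n             ≡⟨ trans (sym (∣⊤∣≡n n)) (∣p∣≡∣p∩q∣+∣p─q∣ ⊤ D) ⟩
  b + ∣ ⊤ ─ D ∣ ∎))
  where
    open ≤-Reasoning
    b = ∣ ⊤ ∩ D ∣
    b≡∣D∣ : b ≡ ∣ D ∣
    b≡∣D∣ = cong ∣_∣ (∩-identityˡ D)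
    rearrange : ∀ b C → b + (b + C) ≡ 2 * b + C
    rearrange = solve-∀

module Strategy {n : ℕ} (C : ℕ) (G : EdgeSet n) (simple : SimpleGraph G)
                (k : ℕ) (2k≤ : 2 * k ≤ n ∸ 4 * C ∸ 1) where

  record Invariant (B Cs : EdgeSet n) : Set where
    field
      matching            : List (Fin n × Fin n)
      untouched           : Subset n
      matching⊆Cs         : All (λ e → Cs (proj₁ e) (proj₂ e) ≡ true) matching
      matching-disjoint   : Unique (vertices matching)
      untouched-unmatched : ∀ x → x ∈ untouched → All (x ≢_) (vertices matching)
      Cs-avoids-untouched : ∀ x y → Cs x y ≡ true → x ∉ untouched
      independent         : Independent B untouched
      covering            : n ≤ 2 * length matching + ∣ untouched ∣
      balanced            : Balanced C (D G) untouched
  open Invariant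

  start : C ≤ n → 2 * ∣ D G ∣ ≤ n ∸ C → Invariant emptyE emptyE
  start C≤n 2∣D∣≤ = record
    { matching            = []
    ; untouched           = ⊤
    ; matching⊆Cs         = []
    ; matching-disjoint   = []
    ; untouched-unmatched = λ _ _ → []
    ; Cs-avoids-untouched = λ _ _ ()
    ; independent         = λ _ _ ()
    ; covering            = ≤-reflexive (sym (∣⊤∣≡n n))
    ; balanced            = initially-balanced C (D G) C≤n 2∣D∣≤
    }

  free-edge : ∀ {B Cs} (I : Invariant B Cs) → 3 + 4 * C ≤ ∣ untouched I ∣
            → ∃₂ λ x y → Free G B Cs x y
  free-edge I large =
    let x , x∈U─D          = ∣p∣>0⇒nonempty (U ─ D G) (≤-trans (s≤s z≤n) 2≤a)
        y , y∈U─D , y∉⁅x⁆  = ∣q∣<∣p∣⇒∃∈p∉q (U ─ D G) ⁅ x ⁆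
                               (subst (_< ∣ U ─ D G ∣) (sym (∣⁅x⁆∣≡1 x)) 2≤a)
        x∈U , x∉D          = x∈p─q⁻ U (D G) x∈U─D
        y∈U , _            = x∈p─q⁻ U (D G) y∈U─D
    in x , y , ≢-sym (x∉⁅y⁆⇒x≢y y∉⁅x⁆) , ∉D⇒non-edge simple (inj₁ x∉D)
     , ¬-not (λ Bxy → independent I x y Bxy x∈U y∈U)
     , ¬-not (λ Csxy → Cs-avoids-untouched I x y Csxy x∈U)
    where
      U = untouched I
      2≤a : 2 ≤ ∣ U ─ D G ∣
      2≤a = ≤-trans (s≤s (s≤s z≤n)) (enough-outside C (D G) U large (balanced I))

  record Answer (B Cs : EdgeSet n) (F : Family n C) (m : ℕ) : Set where
    field
      {u w}   : Fin n
      free    : Free G B Cs w u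
      allowed : w ∉ Family.F F u
      next    : Invariant B (addE Cs w u)
      grown   : length (matching next) ≡ suc m

  respond : ∀ {B B′ Cs p′ q′} (I : Invariant B Cs) (F : Family n C)
          → p′ ∈ untouched I → q′ ∈ untouched I → IndependentExcept B′ (untouched I) p′ q′
          → Partner C (D G) (Family.F F) (untouched I) p′ q′
          → Answer B′ Cs F (length (matching I))
  respond {Cs = Cs} I F p′∈U q′∈U except
          (partner-of {u} {w} u≡p′⊎u≡q′ w∈U w≢p′ w≢q′ w∉Fu admissible) = record
    { free    = w≢u , ∉D⇒non-edge simple (admissible⇒∉D C (D G) admissible)
              , independentExcept⇒non-edge except w∈U u∈U w≢p′ w≢q′
              , ¬-not (λ Cswu → Cs-avoids-untouched I w u Cswu w∈U)
    ; allowed = w∉Fu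
    ; next    = record
      { matching            = (w , u) ∷ matching I
      ; untouched           = U - u - w
      ; matching⊆Cs         = addE-new Cs w u ∷ All.map (addE-⊇ Cs w u) (matching⊆Cs I)
      ; matching-disjoint   = (w≢u ∷ untouched-unmatched I w w∈U)
                            ∷ (untouched-unmatched I u u∈U ∷ matching-disjoint I)
      ; untouched-unmatched = λ x x∈ → let x∈U , x≢u , x≢w = x∈p-y-z⁻ U u w x∈
                                       in x≢w ∷ x≢u ∷ untouched-unmatched I x x∈U
      ; Cs-avoids-untouched = λ x y new x∈ → let x∈U , x≢u , x≢w = x∈p-y-z⁻ U u w x∈ in
          [ (λ old → Cs-avoids-untouched I x y old x∈U) , [ x≢w ∘ proj₁ , x≢u ∘ proj₁ ] ]
            (addE⁻ Cs w u new)
      ; independent         = independentExcept-remove except u≡p′⊎u≡q′ w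
      ; covering            = covering′
      ; balanced            = balanced-remove C (D G) (balanced I) u∈U w∈U admissible
      }
    ; grown   = refl
    }
    where
      U = untouched I
      m = length (matching I)
      u∈U : u ∈ U
      u∈U = [ (λ u≡p′ → subst (_∈ U) (sym u≡p′) p′∈U)
            , (λ u≡q′ → subst (_∈ U) (sym u≡q′) q′∈U) ]′ u≡p′⊎u≡q′
      w≢u : w ≢ u
      w≢u = [ (λ u≡p′ w≡u → w≢p′ (trans w≡u u≡p′))
            , (λ u≡q′ w≡u → w≢q′ (trans w≡u u≡q′)) ] u≡p′⊎u≡q′
      covering′ : n ≤ 2 * suc m + ∣ U - u - w ∣
      covering′ = begin
        n                          ≤⟨ covering I ⟩
        2 * m + ∣ U ∣              ≤⟨ +-monoʳ-≤ (2 * m) (∣p∣≤2+∣p-x-y∣ U u w) ⟩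
        2 * m + (2 + ∣ U - u - w ∣) ≡⟨ rearrange m ∣ U - u - w ∣ ⟩
        2 * suc m + ∣ U - u - w ∣   ∎
        where
          open ≤-Reasoning
          rearrange : ∀ m t → 2 * m + (2 + t) ≡ 2 * suc m + t
          rearrange = solve-∀

  answer : ∀ {B Cs} (I : Invariant B Cs) → 3 + 4 * C ≤ ∣ untouched I ∣
         → ∀ p q (F : Family n C) → Answer (addE B p q) Cs F (length (matching I))
  answer I large p q F =
    let p′ , q′ , p′∈U , q′∈U , except =
          addE-independentExcept (independent I)
            (∣p∣>0⇒nonempty (untouched I) (≤-trans (s≤s z≤n) large)) p q
    in respond I F p′∈U q′∈U except
         (partner C (D G) (Family.F F) (Family.size F) large (balanced I) p′ q′)

  win : ∀ r {B Cs} (I : Invariant B Cs) → k ≤ length (matching I) + r → CWinsB n C G k B Cs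
  win r I k≤m+r with k ≤? length (matching I)
  ... | yes k≤m = won (matching I , k≤m , matching⊆Cs I , matching-disjoint I)
  win zero    I k≤m+0 | no k≰m = contradiction (subst (k ≤_) (+-identityʳ _) k≤m+0) k≰m
  win (suc r) {B} {Cs} I k≤m+1+r | no k≰m =
    step (free-edge I large) λ p q _ F → play (answer I large p q F)
    where
      large : 3 + 4 * C ≤ ∣ untouched I ∣
      large = few-matched⇒large {C = C} (≰⇒> k≰m) 2k≤ (covering I)
      play : ∀ {p q F} → Answer (addE B p q) Cs F (length (matching I))
           → CWinsC n C G k (addE B p q) Cs F
      play A = claim w u free allowed (win r next (subst (k ≤_) m+1+r≡ k≤m+1+r))
        where
          open Answer A
          m+1+r≡ : length (matching I) + suc r ≡ length (matching next) + r
          m+1+r≡ = trans (+-suc _ r) (cong (_+ r) (sym grown))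

lemma2p4 : (n C : ℕ) → 4 * C ≤ n → 3 ≤ n
         → (G : EdgeSet n) → SimpleGraph G
         → 2 * ∣ D G ∣ ≤ n ∸ C
         → ConstructorCanBuildMatching n C G ((n ∸ 4 * C ∸ 1) / 2)
lemma2p4 n C 4C≤n _ G simple 2∣D∣≤n∸C = win k (start C≤n 2∣D∣≤n∸C) ≤-refl
  where
    k = (n ∸ 4 * C ∸ 1) / 2
    C≤n : C ≤ n
    C≤n = ≤-trans (m≤n*m C 4) 4C≤n
    open Strategy C G simple k (≤-trans (≤-reflexive (*-comm 2 k)) (m/n*n≤m _ 2))
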